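{- Let $\mathbb{K}$ be a field of characteristic zero, let $T(f\mid g)$ and $T(l\mid m)$ be elements of the Riordan group with associated families of polynomials $(p_n(x))$ and $(q_n(x))$ respectively, and suppose \[ T(l\mid m)=T(\gamma\mid\alpha+\beta x)\,T(f\mid g)\,T(c\mid a+bx) \] where $\alpha,\beta,\gamma,a,b,c\in\mathbb{K}$ with $\alpha,\gamma,a,c\neq0$. Then for all $n\ge0$ \[ q_n(x)=\frac{\gamma c}{\alpha a}\sum_{k=0}^n\binom{n}{k}\left(-\frac{\beta}{\alpha}\right)^{n-k}\frac{1}{\alpha^k}\,p_k\!\left(\frac{x-b}{a}\right). \]
   Context: For $f,g\in\mathbb{K}[[x]]$ with $g(0)\neq0$, $T(f\mid g)$ is the infinite lower triangular matrix whose $k$-th column has generating function $\frac{f(x)}{g(x)}\left(\frac{x}{g(x)}\right)^k$. The Riordan group is the set of such $T(f\mid g)$ with $f(0)\neq0$, $g(0)\neq0$, under matrix multiplication. The associated family of polynomials of a lower triangular matrix $(a_{n,j})$ is $p_n(x)=\sum_{j=0}^n a_{n,j}x^j$. -}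

module Defs where

open import Level using (Level; _⊔_) renaming (suc to lsuc)
open import Algebra.Bundles using (CommutativeRing)
open import Data.Nat using (ℕ; zero; suc; _∸_; _≤?_)
open import Data.Nat.Combinatorics using (_C_)
open import Relation.Nullary using (¬_; yes; no)

record Field (c ℓ : Level) : Set (lsuc (c ⊔ ℓ)) where
  field
    commutativeRing : CommutativeRing c ℓ
  open CommutativeRing commutativeRing public
  field
    inv     : (x : Carrier) → ¬ (x ≈ 0#) → Carrier
    inverse : (x : Carrier) (p : ¬ (x ≈ 0#)) → (x * inv x p) ≈ 1#
    0≉1     : ¬ (0# ≈ 1#)

module FieldOps {c ℓ : Level} (F : Field c ℓ) where
  open Field F using (Carrier; _≈_; _+_; _*_; -_; 0#; 1#; inv)

  natCast : ℕ → Carrier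
  natCast zero    = 0#
  natCast (suc n) = 1# + natCast n

  pow : Carrier → ℕ → Carrier
  pow x zero    = 1#
  pow x (suc n) = x * pow x n

  sumTo : (ℕ → Carrier) → ℕ → Carrier
  sumTo h zero    = h zero
  sumTo h (suc n) = sumTo h n + h (suc n)

  Series : Set c
  Series = ℕ → Carrier

  zeroS : Series
  zeroS _ = 0#

  constS : Carrier → Series
  constS a zero    = a
  constS a (suc _) = 0#

  oneS : Series
  oneS = constS 1#

  linS : Carrier → Carrier → Series
  linS a b zero          = a
  linS a b (suc zero)    = b
  linS a b (suc (suc _)) = 0#

  addS : Series → Series → Series
  addS s t n = s n + t n

  scaleS : Carrier → Series → Series
  scaleS a s n = a * s n

  mulS : Series → Series → Series
  mulS s t n = sumTo (λ i → s i * t (n ∸ i)) n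

  powS : Series → ℕ → Series
  powS s zero    = oneS
  powS s (suc k) = mulS s (powS s k)

  shiftS : Series → Series
  shiftS s zero    = 0#
  shiftS s (suc n) = s n

  sumS : (ℕ → Series) → ℕ → Series
  sumS s n j = sumTo (λ k → s k j) n

  -- Multiplicative inverse 1/g of a series with g(0) ≠ 0:
  --   h_0 = g_0⁻¹,  h_{n+1} = - g_0⁻¹ Σ_{i=1}^{n+1} g_i h_{n+1-i}.
  -- approx g p n  agrees with 1/g on the indices 0..n.
  module _ (g : Series) (p : ¬ (g 0 ≈ 0#)) where
    private
      g0⁻¹ : Carrier
      g0⁻¹ = inv (g 0) p

    approx : ℕ → Series
    approx zero    _ = g0⁻¹
    approx (suc n) j with j ≤? n
    ... | yes _ = approx n j
    ... | no  _ = - (g0⁻¹ * sumTo (λ i → g (suc i) * approx n (n ∸ i)) n)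

    invS : Series
    invS n = approx n n

  -- Infinite lower triangular matrices as ℕ → ℕ → K (row n, column k)
  Matrix : Set c
  Matrix = ℕ → ℕ → Carrier

  -- product of lower triangular matrices: (A B)_{n,k} = Σ_{j=0}^{n} A_{n,j} B_{j,k}
  _·_ : Matrix → Matrix → Matrix
  (A · B) n k = sumTo (λ j → A n j * B j k) n

  -- T(f | g): the k-th column has generating function (f/g) (x/g)^k
  T : (f g : Series) → ¬ (g 0 ≈ 0#) → Matrix
  T f g p n k = mulS (mulS f (invS g p)) (powS (shiftS (invS g p)) k) n

  -- associated family of polynomials p_n(x) = Σ_{j=0}^{n} a_{n,j} x^j,
  -- each polynomial represented by its coefficient sequence
  assocPoly : Matrix → ℕ → Series
  assocPoly A n = sumS (λ j → scaleS (A n j) (powS (shiftS oneS) j)) n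

  evalPolyAt : (ℕ → Carrier) → ℕ → Series → Series
  evalPolyAt cs d s = sumS (λ j → scaleS (cs j) (powS s j)) d

  assocPolyAt : Matrix → ℕ → Series → Series
  assocPolyAt A n s = evalPolyAt (A n) n s

  binom : ℕ → ℕ → Carrier
  binom n k = natCast (n C k)

CharZero : {c ℓ : Level} → Field c ℓ → Set ℓ
CharZero F = (n : ℕ) → ¬ (natCast (suc n) ≈ 0#)
  where open Field F using (_≈_; 0#)
        open FieldOps F using (natCast)

module Submission where

-- The associated polynomial of a lower triangular matrix R has the
-- row R_n as coefficient sequence, so the claim is an identity between the
-- entries of the triple product.  Two facts make it explicit:
--   * (Riordan arrays with linear denominator)  the entries of T(γ | α + βx)
--     are  (γ/α) [x^k] (ρ + x/α)^n  with  ρ = -β/α.  Both sides' columns are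
--     characterised by their products with α + βx (γ for column 0, and x
--     times the previous column otherwise), and multiplication by α + βx is
--     cancellable because α ≠ 0;
--   * (binomial theorem)  [x^k] (u + vx)^n = C(n,k) u^{n-k} v^k.
-- Expanding the triple product, swapping the two finite sums and using that
-- T(f | g) is lower triangular gives the stated formula after pulling out
-- the constant γc/(αa).

open import Defs
open import Level using (Level)
open import Data.Nat using (ℕ; _∸_)
open import Relation.Nullary using (¬_)

open import Data.Nat using (zero; suc; _≤_; _<_; z≤n; s≤s; _≤?_) renaming (_+_ to _+ℕ_)
import Data.Nat.Properties as ℕₚ
open import Data.Nat.Combinatorics as Combinatorics using (nCk+nC[k+1]≡[n+1]C[k+1]; k>n⇒nCk≡0)
open import Data.Empty using (⊥-elim)
open import Data.Sum using (inj₁; inj₂)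
open import Relation.Nullary using (yes; no)
open import Relation.Binary.PropositionalEquality as ≡ using (_≢_)
import Relation.Binary.Reasoning.Setoid as SetoidReasoning
import Algebra.Properties.Ring as RingProperties
import Algebra.Properties.CommutativeSemigroup as CommutativeSemigroupProperties
import Algebra.Solver.Ring.NaturalCoefficients.Default as SemiringSolver

module Development {cl ℓ : Level} (F : Field cl ℓ) where
  open Field F hiding (zero)
  open FieldOps F
  open RingProperties ring using (-‿distribʳ-*; +-cancelʳ)
  open CommutativeSemigroupProperties +-commutativeSemigroup using (interchange)
  open CommutativeSemigroupProperties *-commutativeSemigroup
    using (x∙yz≈y∙xz) renaming (interchange to *-interchange)
  open SetoidReasoning setoid

  module Rearrange where
    open SemiringSolver commutativeSemiring

    factor-out : ∀ a b c y x → (a * b) * c + (a * y + x) ≈ a * (b * c + y) + x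
    factor-out = solve 5 (λ a b c y x →
      (a :* b) :* c :+ (a :* y :+ x) := a :* (b :* c :+ y) :+ x) refl

    collect₁ : ∀ α β c ρ L → α * (c * (ρ * L)) + β * (c * L) ≈ c * ((α * ρ + β) * L)
    collect₁ = solve 5 (λ α β c ρ L →
      α :* (c :* (ρ :* L)) :+ β :* (c :* L) := c :* ((α :* ρ :+ β) :* L)) refl

    collect₂ : ∀ α β c ρ v L₁ L₀ →
      α * (c * (ρ * L₁ + v * L₀)) + β * (c * L₁) ≈ c * ((α * ρ + β) * L₁) + c * ((α * v) * L₀)
    collect₂ = solve 7 (λ α β c ρ v L₁ L₀ →
      α :* (c :* (ρ :* L₁ :+ v :* L₀)) :+ β :* (c :* L₁)
        := c :* ((α :* ρ :+ β) :* L₁) :+ c :* ((α :* v) :* L₀)) refl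

  sumTo-cong : ∀ {h h'} n → (∀ i → i ≤ n → h i ≈ h' i) → sumTo h n ≈ sumTo h' n
  sumTo-cong zero    eq = eq 0 z≤n
  sumTo-cong (suc n) eq =
    +-cong (sumTo-cong n (λ i i≤n → eq i (ℕₚ.m≤n⇒m≤1+n i≤n))) (eq (suc n) ℕₚ.≤-refl)

  sumTo-congʷ : ∀ {h h'} n → (∀ i → h i ≈ h' i) → sumTo h n ≈ sumTo h' n
  sumTo-congʷ n eq = sumTo-cong n (λ i _ → eq i)

  sumTo-zero : ∀ {h} n → (∀ i → i ≤ n → h i ≈ 0#) → sumTo h n ≈ 0#
  sumTo-zero n eq = trans (sumTo-cong n eq) (sumTo-const0 n)
    where
      sumTo-const0 : ∀ n → sumTo (λ _ → 0#) n ≈ 0#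
      sumTo-const0 zero    = refl
      sumTo-const0 (suc n) = trans (+-cong (sumTo-const0 n) refl) (+-identityˡ 0#)

  sumTo-+ : ∀ h h' n → sumTo (λ i → h i + h' i) n ≈ sumTo h n + sumTo h' n
  sumTo-+ h h' zero    = refl
  sumTo-+ h h' (suc n) = trans (+-cong (sumTo-+ h h' n) refl) (interchange _ _ _ _)

  sumTo-*ˡ : ∀ a h n → a * sumTo h n ≈ sumTo (λ i → a * h i) n
  sumTo-*ˡ a h zero    = refl
  sumTo-*ˡ a h (suc n) = trans (distribˡ a _ _) (+-cong (sumTo-*ˡ a h n) refl)

  sumTo-*ʳ : ∀ a h n → sumTo h n * a ≈ sumTo (λ i → h i * a) n
  sumTo-*ʳ a h zero    = refl
  sumTo-*ʳ a h (suc n) = trans (distribʳ a _ _) (+-cong (sumTo-*ʳ a h n) refl)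

  sumTo-suc : ∀ h n → sumTo h (suc n) ≈ h 0 + sumTo (λ i → h (suc i)) n
  sumTo-suc h zero    = refl
  sumTo-suc h (suc n) = trans (+-cong (sumTo-suc h n) refl) (+-assoc _ _ _)

  sumTo-head : ∀ h n → (∀ i → h (suc i) ≈ 0#) → sumTo h n ≈ h 0
  sumTo-head h zero    _  = refl
  sumTo-head h (suc n) eq = trans (+-cong (sumTo-head h n eq) (eq n)) (+-identityʳ _)

  sumTo-single : ∀ h n m → m ≤ n → (∀ i → i ≤ n → i ≢ m → h i ≈ 0#) → sumTo h n ≈ h m
  sumTo-single h zero    .zero z≤n eq = refl
  sumTo-single h (suc n) m m≤1+n eq with ℕₚ.m≤n⇒m<n∨m≡n m≤1+n
  ... | inj₁ m<1+n = trans (+-cong (sumTo-single h n m (ℕₚ.≤-pred m<1+n) eq′)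
                                   (eq (suc n) ℕₚ.≤-refl (λ 1+n≡m → ℕₚ.<⇒≢ m<1+n (≡.sym 1+n≡m))))
                           (+-identityʳ _)
    where
      eq′ : ∀ i → i ≤ n → i ≢ m → h i ≈ 0#
      eq′ i i≤n = eq i (ℕₚ.m≤n⇒m≤1+n i≤n)
  ... | inj₂ ≡.refl = trans (+-cong (sumTo-zero n (λ i i≤n → eq i (ℕₚ.m≤n⇒m≤1+n i≤n) (ℕₚ.<⇒≢ (s≤s i≤n))))
                                    refl)
                            (+-identityˡ _)

  sumTo-truncate : ∀ h k n → k ≤ n → (∀ i → k < i → h i ≈ 0#) → sumTo h n ≈ sumTo h k
  sumTo-truncate h .zero zero    z≤n  eq = refl
  sumTo-truncate h k     (suc n) k≤1+n eq with ℕₚ.m≤n⇒m<n∨m≡n k≤1+n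
  ... | inj₁ k<1+n = trans (+-cong (sumTo-truncate h k n (ℕₚ.≤-pred k<1+n) eq) (eq (suc n) k<1+n))
                           (+-identityʳ _)
  ... | inj₂ ≡.refl = refl

  sumTo-swap : ∀ (G : ℕ → ℕ → Carrier) n m →
    sumTo (λ i → sumTo (G i) m) n ≈ sumTo (λ j → sumTo (λ i → G i j) n) m
  sumTo-swap G zero    m = refl
  sumTo-swap G (suc n) m =
    trans (+-cong (sumTo-swap G n m) refl) (sym (sumTo-+ _ (G (suc n)) m))

  mulS-congˡ : ∀ s s' t → (∀ i → s i ≈ s' i) → ∀ n → mulS s t n ≈ mulS s' t n
  mulS-congˡ s s' t eq n = sumTo-congʷ n (λ i → *-cong (eq i) refl)

  mulS-congʳ : ∀ s t t' → (∀ i → t i ≈ t' i) → ∀ n → mulS s t n ≈ mulS s t' n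
  mulS-congʳ s t t' eq n = sumTo-congʷ n (λ i → *-cong refl (eq (n ∸ i)))

  mulS-constˡ : ∀ c t n → mulS (constS c) t n ≈ c * t n
  mulS-constˡ c t n = sumTo-head _ n (λ i → zeroˡ _)

  mulS-scaleˡ : ∀ c s t n → mulS (scaleS c s) t n ≈ c * mulS s t n
  mulS-scaleˡ c s t n = trans (sumTo-congʷ n (λ i → *-assoc c (s i) _)) (sym (sumTo-*ˡ c _ n))

  mulS-scaleʳ : ∀ c s t n → mulS s (scaleS c t) n ≈ c * mulS s t n
  mulS-scaleʳ c s t n = trans (sumTo-congʷ n (λ i → x∙yz≈y∙xz (s i) c _)) (sym (sumTo-*ˡ c _ n))

  mulS-addˡ : ∀ s s' t n → mulS (addS s s') t n ≈ mulS s t n + mulS s' t n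
  mulS-addˡ s s' t n = trans (sumTo-congʷ n (λ i → distribʳ _ (s i) (s' i))) (sumTo-+ _ _ n)

  mulS-suc : ∀ s t n → mulS s t (suc n) ≈ s 0 * t (suc n) + mulS (λ i → s (suc i)) t n
  mulS-suc s t n = sumTo-suc _ n

  mulS-shiftˡ : ∀ s t n → mulS (shiftS s) t n ≈ shiftS (mulS s t) n
  mulS-shiftˡ s t zero    = zeroˡ _
  mulS-shiftˡ s t (suc n) = trans (mulS-suc (shiftS s) t n) (trans (+-cong (zeroˡ _) refl) (+-identityˡ _))

  mulS-assoc : ∀ n s t u → mulS (mulS s t) u n ≈ mulS s (mulS t u) n
  mulS-assoc zero    s t u = *-assoc _ _ _
  mulS-assoc (suc n) s t u = begin
      mulS (mulS s t) u (suc n)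
    ≈⟨ mulS-suc (mulS s t) u n ⟩
      (s 0 * t 0) * u (suc n) + mulS (λ i → mulS s t (suc i)) u n
    ≈⟨ +-cong refl (mulS-congˡ _ _ u (mulS-suc s t) n) ⟩
      (s 0 * t 0) * u (suc n) + mulS (addS (scaleS (s 0) t′) (mulS s′ t)) u n
    ≈⟨ +-cong refl (trans (mulS-addˡ _ _ u n) (+-cong (mulS-scaleˡ (s 0) t′ u n) (mulS-assoc n s′ t u))) ⟩
      (s 0 * t 0) * u (suc n) + (s 0 * mulS t′ u n + mulS s′ (mulS t u) n)
    ≈⟨ Rearrange.factor-out _ _ _ _ _ ⟩
      s 0 * (t 0 * u (suc n) + mulS t′ u n) + mulS s′ (mulS t u) n
    ≈⟨ sym (trans (mulS-suc s (mulS t u) n) (+-cong (*-cong refl (mulS-suc t u n)) refl)) ⟩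
      mulS s (mulS t u) (suc n)
    ∎
    where
      s′ t′ : Series
      s′ i = s (suc i)
      t′ i = t (suc i)

  mulS-linSˡ : ∀ a b s n → mulS (linS a b) s (suc n) ≈ a * s (suc n) + b * s n
  mulS-linSˡ a b s n = trans (mulS-suc _ s n) (+-cong refl (sumTo-head _ n (λ i → zeroˡ _)))

  scaleS-oneS : ∀ c n → c * oneS n ≈ constS c n
  scaleS-oneS c zero    = *-identityʳ c
  scaleS-oneS c (suc n) = zeroʳ c

  shiftS-cong : ∀ s t → (∀ i → s i ≈ t i) → ∀ n → shiftS s n ≈ shiftS t n
  shiftS-cong s t eq zero    = refl
  shiftS-cong s t eq (suc n) = eq n

  LowerTriangular : Matrix → Set ℓ
  LowerTriangular A = ∀ n k → n < k → A n k ≈ 0#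

  powS-shiftS-order : ∀ s k n → n < k → powS (shiftS s) k n ≈ 0#
  powS-shiftS-order s (suc k) zero    _   = mulS-shiftˡ s (powS (shiftS s) k) zero
  powS-shiftS-order s (suc k) (suc n) n<k =
    trans (mulS-shiftˡ s (powS (shiftS s) k) (suc n))
          (sumTo-zero n (λ i _ → trans (*-cong refl (powS-shiftS-order s k (n ∸ i) (n∸i<k i))) (zeroʳ _)))
    where
      n∸i<k : ∀ i → n ∸ i < k
      n∸i<k i = ℕₚ.≤-<-trans (ℕₚ.m∸n≤m n i) (ℕₚ.≤-pred n<k)

  -- Every matrix T(f | g) is lower triangular: its k-th column is a multiple of (x/g)^k.
  T-lowerTriangular : ∀ f g (g0 : ¬ (g 0 ≈ 0#)) → LowerTriangular (T f g g0)
  T-lowerTriangular f g g0 n k n<k = sumTo-zero n (λ i _ →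
    trans (*-cong refl (powS-shiftS-order (invS g g0) k (n ∸ i) (ℕₚ.≤-<-trans (ℕₚ.m∸n≤m n i) n<k)))
          (zeroʳ _))

  monomial-suc : ∀ i n → powS (shiftS oneS) (suc i) (suc n) ≈ powS (shiftS oneS) i n
  monomial-suc i n = trans (mulS-shiftˡ oneS (powS (shiftS oneS) i) (suc n))
                           (trans (mulS-constˡ 1# (powS (shiftS oneS) i) n) (*-identityˡ _))

  monomial-diag : ∀ i → powS (shiftS oneS) i i ≈ 1#
  monomial-diag zero    = refl
  monomial-diag (suc i) = trans (monomial-suc i i) (monomial-diag i)

  monomial-offDiag : ∀ i j → i ≢ j → powS (shiftS oneS) i j ≈ 0#
  monomial-offDiag zero    zero    i≢j = ⊥-elim (i≢j ≡.refl)
  monomial-offDiag zero    (suc j) _   = refl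
  monomial-offDiag (suc i) zero    _   = mulS-shiftˡ oneS (powS (shiftS oneS) i) zero
  monomial-offDiag (suc i) (suc j) i≢j =
    trans (monomial-suc i j) (monomial-offDiag i j (λ i≡j → i≢j (≡.cong suc i≡j)))

  monomial-term : ∀ a i j → i ≢ j → a * powS (shiftS oneS) i j ≈ 0#
  monomial-term a i j i≢j = trans (*-cong refl (monomial-offDiag i j i≢j)) (zeroʳ a)

  assocPoly-coeff : ∀ A → LowerTriangular A → ∀ n j → assocPoly A n j ≈ A n j
  assocPoly-coeff A lower n j with j ≤? n
  ... | yes j≤n = trans (sumTo-single _ n j j≤n (λ i _ i≢j → monomial-term (A n i) i j i≢j))
                        (trans (*-cong refl (monomial-diag j)) (*-identityʳ _))
  ... | no  j≰n = trans (sumTo-zero n (λ i i≤n → monomial-term (A n i) i j (λ { ≡.refl → j≰n i≤n })))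
                        (sym (lower n j (ℕₚ.≰⇒> j≰n)))

  triple-product : ∀ A B C → LowerTriangular B → ∀ n j →
    ((A · B) · C) n j ≈ sumTo (λ k → A n k * sumTo (λ i → B k i * C i j) k) n
  triple-product A B C lower n j = begin
      sumTo (λ i → sumTo (λ k → A n k * B k i) n * C i j) n
    ≈⟨ sumTo-congʷ n (λ i → sumTo-*ʳ (C i j) _ n) ⟩
      sumTo (λ i → sumTo (λ k → (A n k * B k i) * C i j) n) n
    ≈⟨ sumTo-swap (λ i k → (A n k * B k i) * C i j) n n ⟩
      sumTo (λ k → sumTo (λ i → (A n k * B k i) * C i j) n) n
    ≈⟨ sumTo-cong n row ⟩
      sumTo (λ k → A n k * sumTo (λ i → B k i * C i j) k) n
    ∎
    where
      row : ∀ k → k ≤ n →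
            sumTo (λ i → (A n k * B k i) * C i j) n ≈ A n k * sumTo (λ i → B k i * C i j) k
      row k k≤n = begin
          sumTo (λ i → (A n k * B k i) * C i j) n
        ≈⟨ sumTo-congʷ n (λ i → *-assoc _ _ _) ⟩
          sumTo (λ i → A n k * (B k i * C i j)) n
        ≈⟨ sumTo-truncate _ k n k≤n (λ i k<i →
             trans (*-cong refl (trans (*-cong (lower k i k<i) refl) (zeroˡ _))) (zeroʳ _)) ⟩
          sumTo (λ i → A n k * (B k i * C i j)) k
        ≈⟨ sym (sumTo-*ˡ _ _ k) ⟩
          A n k * sumTo (λ i → B k i * C i j) k
        ∎

  triple-product-scaled : ∀ A B C → LowerTriangular B → ∀ n j (s t : Carrier) (a c : ℕ → Carrier) →
    (∀ k → A n k ≈ s * a k) → (∀ i → C i j ≈ t * c i) →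
    ((A · B) · C) n j ≈ (s * t) * sumTo (λ k → a k * sumTo (λ i → B k i * c i) k) n
  triple-product-scaled A B C lower n j s t a c A≈ C≈ = begin
      ((A · B) · C) n j
    ≈⟨ triple-product A B C lower n j ⟩
      sumTo (λ k → A n k * sumTo (λ i → B k i * C i j) k) n
    ≈⟨ sumTo-congʷ n (λ k → *-cong (A≈ k) (column-sum k)) ⟩
      sumTo (λ k → (s * a k) * (t * sumTo (λ i → B k i * c i) k)) n
    ≈⟨ sumTo-congʷ n (λ k → *-interchange s (a k) t _) ⟩
      sumTo (λ k → (s * t) * (a k * sumTo (λ i → B k i * c i) k)) n
    ≈⟨ sym (sumTo-*ˡ (s * t) _ n) ⟩
      (s * t) * sumTo (λ k → a k * sumTo (λ i → B k i * c i) k) n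
    ∎
    where
      column-sum : ∀ k → sumTo (λ i → B k i * C i j) k ≈ t * sumTo (λ i → B k i * c i) k
      column-sum k = trans (sumTo-congʷ k (λ i → trans (*-cong refl (C≈ i)) (x∙yz≈y∙xz (B k i) t (c i))))
                           (sym (sumTo-*ˡ t _ k))

  -- The binomial theorem for (u + vx)^n, coefficientwise.

  natCast-+ : ∀ a b → natCast (a +ℕ b) ≈ natCast a + natCast b
  natCast-+ zero    b = sym (+-identityˡ _)
  natCast-+ (suc a) b = trans (+-cong refl (natCast-+ a b)) (sym (+-assoc _ _ _))

  binom-pascal : ∀ n k → binom (suc n) (suc k) ≈ binom n k + binom n (suc k)
  binom-pascal n k = trans (reflexive (≡.cong natCast (≡.sym (nCk+nC[k+1]≡[n+1]C[k+1] n k))))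
                           (natCast-+ (n Combinatorics.C k) (n Combinatorics.C suc k))

  -- u C(n,k+1) u^{n-k-1} = C(n,k+1) u^{n-k}; when k ≥ n both sides vanish.
  binom-absorb : ∀ u n k → u * (binom n (suc k) * pow u (n ∸ suc k)) ≈ binom n (suc k) * pow u (n ∸ k)
  binom-absorb u n k with suc k ≤? n
  ... | yes k<n = trans (x∙yz≈y∙xz u _ _)
                        (*-cong refl (reflexive (≡.cong (pow u) (≡.sym (ℕₚ.+-∸-assoc 1 k<n)))))
  ... | no  k≮n = trans (*-cong refl (vanish (pow u (n ∸ suc k)))) (trans (zeroʳ u) (sym (vanish _)))
    where
      vanish : ∀ x → binom n (suc k) * x ≈ 0#
      vanish x = trans (*-cong (reflexive (≡.cong natCast (k>n⇒nCk≡0 (ℕₚ.≰⇒> k≮n)))) refl) (zeroˡ x)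

  powS-linS-coeff : ∀ u v n k → powS (linS u v) n k ≈ binom n k * pow u (n ∸ k) * pow v k
  powS-linS-coeff u v zero    zero    = sym (trans (*-identityʳ _) (trans (*-identityʳ _) (+-identityʳ 1#)))
  powS-linS-coeff u v zero    (suc k) = sym (trans (*-cong (zeroˡ _) refl) (zeroˡ _))
  powS-linS-coeff u v (suc n) zero    =
    trans (*-cong refl (powS-linS-coeff u v n zero))
          (trans (sym (*-assoc _ _ _)) (*-cong (x∙yz≈y∙xz u _ _) refl))
  powS-linS-coeff u v (suc n) (suc k) = begin
      powS (linS u v) (suc n) (suc k)
    ≈⟨ mulS-linSˡ u v (powS (linS u v) n) k ⟩
      u * powS (linS u v) n (suc k) + v * powS (linS u v) n k
    ≈⟨ +-cong (*-cong refl (powS-linS-coeff u v n (suc k))) (*-cong refl (powS-linS-coeff u v n k)) ⟩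
      u * ((B₁ * pow u (n ∸ suc k)) * (v * V)) + v * ((B₀ * U) * V)
    ≈⟨ +-cong (trans (sym (*-assoc _ _ _)) (*-cong (binom-absorb u n k) refl))
              (x∙yz≈y∙xz v _ _) ⟩
      (B₁ * U) * (v * V) + (B₀ * U) * (v * V)
    ≈⟨ trans (sym (distribʳ _ _ _)) (*-cong (trans (sym (distribʳ _ _ _)) (*-cong (+-comm _ _) refl)) refl) ⟩
      (B₀ + B₁) * U * (v * V)
    ≈⟨ *-cong (*-cong (sym (binom-pascal n k)) refl) refl ⟩
      binom (suc n) (suc k) * pow u (suc n ∸ suc k) * pow v (suc k)
    ∎
    where
      B₀ B₁ U V : Carrier
      B₀ = binom n k
      B₁ = binom n (suc k)
      U  = pow u (n ∸ k)
      V  = pow v k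

  -- Riordan arrays with a linear denominator α + βx, α ≠ 0.

  *-cancelˡ : ∀ α → ¬ (α ≈ 0#) → ∀ x y → α * x ≈ α * y → x ≈ y
  *-cancelˡ α α0 x y eq = begin
      x                   ≈⟨ sym (trans (*-cong (trans (*-comm _ _) (inverse α α0)) refl) (*-identityˡ x)) ⟩
      (inv α α0 * α) * x  ≈⟨ trans (*-assoc _ _ _) (trans (*-cong refl eq) (sym (*-assoc _ _ _))) ⟩
      (inv α α0 * α) * y  ≈⟨ trans (*-cong (trans (*-comm _ _) (inverse α α0)) refl) (*-identityˡ y) ⟩
      y                   ∎

  linS-cancel : ∀ α β → ¬ (α ≈ 0#) → ∀ s t →
    (∀ n → mulS (linS α β) s n ≈ mulS (linS α β) t n) → ∀ n → s n ≈ t n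
  linS-cancel α β α0 s t eq zero    = *-cancelˡ α α0 _ _ (eq zero)
  linS-cancel α β α0 s t eq (suc n) = *-cancelˡ α α0 _ _ (+-cancelʳ (β * t n) _ _ (begin
      α * s (suc n) + β * t n  ≈⟨ +-cong refl (*-cong refl (sym (linS-cancel α β α0 s t eq n))) ⟩
      α * s (suc n) + β * s n  ≈⟨ sym (mulS-linSˡ α β s n) ⟩
      mulS (linS α β) s (suc n) ≈⟨ eq (suc n) ⟩
      mulS (linS α β) t (suc n) ≈⟨ mulS-linSˡ α β t n ⟩
      α * t (suc n) + β * t n  ∎))

  linS-inverse : ∀ α β (α0 : ¬ (α ≈ 0#)) n → mulS (linS α β) (invS (linS α β) α0) n ≈ oneS n
  linS-inverse α β α0 zero    = inverse α α0
  linS-inverse α β α0 (suc n) = begin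
      mulS (linS α β) h (suc n)      ≈⟨ mulS-linSˡ α β h n ⟩
      α * h (suc n) + y              ≈⟨ +-cong (*-cong refl recurrence) refl ⟩
      α * - (inv α α0 * y) + y       ≈⟨ +-cong (sym (-‿distribʳ-* α _)) refl ⟩
      - (α * (inv α α0 * y)) + y     ≈⟨ +-cong (-‿cong (trans (sym (*-assoc _ _ _))
                                          (trans (*-cong (inverse α α0) refl) (*-identityˡ y)))) refl ⟩
      - y + y                        ≈⟨ -‿inverseˡ y ⟩
      0#                             ∎
    where
      h : Series
      h = invS (linS α β) α0
      y : Carrier
      y = β * h n
      recurrence : h (suc n) ≈ - (inv α α0 * y)
      recurrence with suc n ≤? n
      ... | yes n<n = ⊥-elim (ℕₚ.n≮n n n<n)
      ... | no  _   = -‿cong (*-cong refl (sumTo-head _ n (λ i → zeroˡ _)))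

  module LinearDenominator (γ α β : Carrier) (α0 : ¬ (α ≈ 0#)) where
    v ρ : Carrier
    v = inv α α0
    ρ = - (β * v)

    lin h : Series
    lin = linS α β
    h   = invS lin α0

    column candidate : ℕ → Series
    column    k n = T (constS γ) lin α0 n k
    candidate k n = (γ * v) * powS (linS ρ v) n k

    αρ+β≈0 : α * ρ + β ≈ 0#
    αρ+β≈0 = begin
        α * - (β * v) + β    ≈⟨ +-cong (sym (-‿distribʳ-* α _)) refl ⟩
        - (α * (β * v)) + β  ≈⟨ +-cong (-‿cong (trans (x∙yz≈y∙xz α β v)
                                   (trans (*-cong refl (inverse α α0)) (*-identityʳ β)))) refl ⟩
        - β + β              ≈⟨ -‿inverseˡ β ⟩
        0#                   ∎

    lin·column : ∀ k n → mulS lin (column k) n ≈ γ * powS (shiftS h) k n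
    lin·column k n = begin
        mulS lin (mulS G Q) n    ≈⟨ sym (mulS-assoc n lin G Q) ⟩
        mulS (mulS lin G) Q n    ≈⟨ mulS-congˡ _ (constS γ) Q lin·G n ⟩
        mulS (constS γ) Q n      ≈⟨ mulS-constˡ γ Q n ⟩
        γ * Q n                  ∎
      where
        G Q : Series
        G = mulS (constS γ) h
        Q = powS (shiftS h) k
        lin·G : ∀ n → mulS lin G n ≈ constS γ n
        lin·G n = trans (mulS-congʳ lin _ (scaleS γ h) (mulS-constˡ γ h) n)
                        (trans (mulS-scaleʳ γ lin h n)
                               (trans (*-cong refl (linS-inverse α β α0 n)) (scaleS-oneS γ n)))

    lin·column-suc : ∀ k n → mulS lin (column (suc k)) n ≈ shiftS (column k) n
    lin·column-suc k n = trans (lin·column (suc k) n) (trans (*-cong refl (mulS-shiftˡ h Q n)) (shifted n))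
      where
        Q : Series
        Q = powS (shiftS h) k
        shifted : ∀ n → γ * shiftS (mulS h Q) n ≈ shiftS (column k) n
        shifted zero    = zeroʳ γ
        shifted (suc n) = sym (trans (mulS-congˡ _ (scaleS γ h) Q (mulS-constˡ γ h) n) (mulS-scaleˡ γ h Q n))

    lin·candidate-zero : ∀ n → mulS lin (candidate 0) n ≈ constS γ n
    lin·candidate-zero zero    = begin
        α * ((γ * v) * 1#)  ≈⟨ *-cong refl (*-identityʳ _) ⟩
        α * (γ * v)         ≈⟨ x∙yz≈y∙xz α γ v ⟩
        γ * (α * v)         ≈⟨ *-cong refl (inverse α α0) ⟩
        γ * 1#              ≈⟨ *-identityʳ γ ⟩
        γ                   ∎
    lin·candidate-zero (suc n) = begin
        mulS lin (candidate 0) (suc n)   ≈⟨ mulS-linSˡ α β (candidate 0) n ⟩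
        α * (c * (ρ * L)) + β * (c * L)  ≈⟨ Rearrange.collect₁ α β c ρ L ⟩
        c * ((α * ρ + β) * L)            ≈⟨ *-cong refl (trans (*-cong αρ+β≈0 refl) (zeroˡ L)) ⟩
        c * 0#                           ≈⟨ zeroʳ c ⟩
        0#                               ∎
      where
        c L : Carrier
        c = γ * v
        L = powS (linS ρ v) n 0

    lin·candidate-suc : ∀ k n → mulS lin (candidate (suc k)) n ≈ shiftS (candidate k) n
    lin·candidate-suc k zero    = trans (*-cong refl (zeroʳ _)) (zeroʳ α)
    lin·candidate-suc k (suc n) = begin
        mulS lin (candidate (suc k)) (suc n)
      ≈⟨ mulS-linSˡ α β (candidate (suc k)) n ⟩
        α * (c * powS (linS ρ v) (suc n) (suc k)) + β * (c * L₁)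
      ≈⟨ +-cong (*-cong refl (*-cong refl (mulS-linSˡ ρ v (powS (linS ρ v) n) k))) refl ⟩
        α * (c * (ρ * L₁ + v * L₀)) + β * (c * L₁)
      ≈⟨ Rearrange.collect₂ α β c ρ v L₁ L₀ ⟩
        c * ((α * ρ + β) * L₁) + c * ((α * v) * L₀)
      ≈⟨ +-cong (trans (*-cong refl (trans (*-cong αρ+β≈0 refl) (zeroˡ L₁))) (zeroʳ c))
                (*-cong refl (trans (*-cong (inverse α α0) refl) (*-identityˡ L₀))) ⟩
        0# + c * L₀
      ≈⟨ +-identityˡ _ ⟩
        candidate k n
      ∎
      where
        c L₁ L₀ : Carrier
        c  = γ * v
        L₁ = powS (linS ρ v) n (suc k)
        L₀ = powS (linS ρ v) n k

    -- Columns and candidates satisfy the same recursion after multiplication by α + βx.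
    column≈candidate : ∀ k n → column k n ≈ candidate k n
    column≈candidate zero    = linS-cancel α β α0 _ _ (λ n →
      trans (trans (lin·column 0 n) (scaleS-oneS γ n)) (sym (lin·candidate-zero n)))
    column≈candidate (suc k) = linS-cancel α β α0 _ _ (λ n →
      trans (lin·column-suc k n)
            (trans (shiftS-cong _ _ (column≈candidate k) n) (sym (lin·candidate-suc k n))))

  T-linearDenominator : ∀ γ α β (α0 : ¬ (α ≈ 0#)) n k →
    T (constS γ) (linS α β) α0 n k ≈ (γ * inv α α0) * powS (linS (- (β * inv α α0)) (inv α α0)) n k
  T-linearDenominator γ α β α0 n k = LinearDenominator.column≈candidate γ α β α0 k n

mainTheorem7 : {cl ℓ : Level} (F : Field cl ℓ) → CharZero F →
    let open Field F
        open FieldOps F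
    in (f g l m : Series) →
       ¬ (f 0 ≈ 0#) → (g0 : ¬ (g 0 ≈ 0#)) →
       ¬ (l 0 ≈ 0#) → (m0 : ¬ (m 0 ≈ 0#)) →
       (α β γ a b c : Carrier) →
       (α0 : ¬ (α ≈ 0#)) → ¬ (γ ≈ 0#) → (a0 : ¬ (a ≈ 0#)) → ¬ (c ≈ 0#) →
       ((n k : ℕ) → T l m m0 n k ≈
          ((T (constS γ) (linS α β) α0 · T f g g0) · T (constS c) (linS a b) a0) n k) →
       (n j : ℕ) →
       assocPoly (T l m m0) n j ≈
         scaleS (γ * c * inv α α0 * inv a a0)
           (sumS (λ k → scaleS (binom n k * pow (- (β * inv α α0)) (n ∸ k) * pow (inv α α0) k)
                               (assocPolyAt (T f g g0) k
                                  (linS (- (b * inv a a0)) (inv a a0))))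
                 n) j
mainTheorem7 F _ f g l m _ g0 _ m0 α β γ a b c α0 _ a0 _ factorisation n j = begin
    assocPoly (T l m m0) n j
  ≈⟨ assocPoly-coeff _ (T-lowerTriangular l m m0) n j ⟩
    T l m m0 n j
  ≈⟨ factorisation n j ⟩
    ((A · B) · C) n j
  ≈⟨ triple-product-scaled A B C (T-lowerTriangular f g g0) n j (γ * v) (c * v′) w (λ i → powS Y i j)
       (λ k → trans (T-linearDenominator γ α β α0 n k) (*-cong refl (powS-linS-coeff _ _ n k)))
       (λ i → T-linearDenominator c a b a0 i j) ⟩
    ((γ * v) * (c * v′)) * sumTo (λ k → w k * sumTo (λ i → B k i * powS Y i j) k) n
  ≈⟨ *-cong (trans (*-interchange γ v c v′) (sym (*-assoc _ _ _))) refl ⟩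
    (γ * c * v * v′) * sumTo (λ k → w k * sumTo (λ i → B k i * powS Y i j) k) n
  ∎
  where
    open Field F hiding (zero)
    open FieldOps F
    open Development F
    open SetoidReasoning setoid
    open CommutativeSemigroupProperties *-commutativeSemigroup using () renaming (interchange to *-interchange)
    A B C : Matrix
    A = T (constS γ) (linS α β) α0
    B = T f g g0
    C = T (constS c) (linS a b) a0
    v v′ : Carrier
    v  = inv α α0
    v′ = inv a a0
    Y : Series
    Y = linS (- (b * v′)) v′
    w : ℕ → Carrier
    w k = binom n k * pow (- (β * v)) (n ∸ k) * pow v k
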